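{- Let $G$ be the $d$-regular hypercube $Q_d$ with $d\geq 3$. Then $\chi_s(G)\geq \left\lceil\frac{d+5}{2}\right\rceil$.
   Context: The hypercube $Q_d$ has vertex set $\{0,1\}^d$, two vertices adjacent iff they differ in exactly one coordinate. A $k$-star colouring of a graph is a proper vertex colouring with $k$ colours in which no path on 4 vertices receives only two colours; $\chi_s(G)$ is the least $k$ for which $G$ has a $k$-star colouring. -}

module Defs where

open import Data.Nat using (ℕ; zero; suc; _+_)
open import Data.Bool using (Bool; true; false; _≟_)
open import Data.Vec using (Vec; []; _∷_)
open import Data.Fin using (Fin)
open import Data.Product using (_×_; ∃₂)
open import Data.Sum using (_⊎_)
open import Relation.Binary.PropositionalEquality using (_≡_)
open import Relation.Nullary using (¬_; yes; no)

hamming : ∀ {d} → Vec Bool d → Vec Bool d → ℕ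
hamming [] [] = 0
hamming (x ∷ xs) (y ∷ ys) with x ≟ y
... | yes _ = hamming xs ys
... | no _  = suc (hamming xs ys)

Adj : ∀ {d} → Vec Bool d → Vec Bool d → Set
Adj u v = hamming u v ≡ 1

Proper : ∀ {d k} → (Vec Bool d → Fin k) → Set
Proper {d} c = ∀ (u v : Vec Bool d) → Adj u v → ¬ (c u ≡ c v)

IsP4 : ∀ {d} → Vec Bool d → Vec Bool d → Vec Bool d → Vec Bool d → Set
IsP4 v₁ v₂ v₃ v₄ =
  Adj v₁ v₂ × Adj v₂ v₃ × Adj v₃ v₄ ×
  ¬ (v₁ ≡ v₂) × ¬ (v₁ ≡ v₃) × ¬ (v₁ ≡ v₄) ×
  ¬ (v₂ ≡ v₃) × ¬ (v₂ ≡ v₄) × ¬ (v₃ ≡ v₄)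

_∈₂_,_ : ∀ {k} → Fin k → Fin k → Fin k → Set
x ∈₂ a , b = (x ≡ a) ⊎ (x ≡ b)

StarColouring : (d k : ℕ) → (Vec Bool d → Fin k) → Set
StarColouring d k c =
  Proper c ×
  (∀ v₁ v₂ v₃ v₄ → IsP4 v₁ v₂ v₃ v₄ →
     ¬ ∃₂ (λ a b → (c v₁ ∈₂ a , b) × (c v₂ ∈₂ a , b) ×
                   (c v₃ ∈₂ a , b) × (c v₄ ∈₂ a , b)))

-- Call a colour unique at v if exactly one neighbour of v carries it. In a star colouring, on
-- every edge uv the colour of u is unique at v or the colour of v is unique at u, for otherwise
-- the two colours would span a bicoloured P₄; double counting over the edges, the vertices have
-- on average at least d/2 neighbours of unique colour. If 2k ≤ d + 4, the colours around a
-- vertex v (its own colour, absent from its neighbourhood, the unique ones and the repeated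
-- ones) leave room for at most d/2 of them, so every vertex has exactly d/2 unique neighbours,
-- exactly one repeated colour b, and no absent colour other than its own. For a neighbour u of v
-- of colour b, the d/2 neighbours u + eₗ with v + eₗ of colour b all have unique colours at u,
-- so they are the only ones. The repeated colour e of u occurs at some neighbour w = v + eₗ,
-- and then u + eₗ, a neighbour of u whose colour is not unique, has colour e as well; but it
-- is adjacent to w.

module Submission where

open import Defs
open import Data.Nat using (ℕ; _+_; _≤_; ⌈_/2⌉)
open import Data.Bool using (Bool)
open import Data.Vec using (Vec)
open import Data.Fin using (Fin)

open import Data.Nat using (zero; suc; _*_; _<_; z≤n; s≤s; s≤s⁻¹; _≤?_) renaming (_≟_ to _≟ℕ_)
open import Data.Nat.Properties
  using (≤-reflexive; ≤-trans; ≤-antisym; +-mono-≤; +-monoʳ-≤; +-monoˡ-≤; +-monoʳ-<; +-mono-<;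
         +-cancelˡ-≤; +-cancelʳ-≤; +-cancelˡ-≡; +-identityʳ; +-suc; +-comm; *-zeroʳ; *-distribʳ-+;
         m≤m+n; m≤n+m; ≰⇒>; ≮⇒≥; <⇒≱; n<1+n; n≢0⇒n>0; ≤∧≢⇒<; ⌈n/2⌉-mono; n≡⌈n+n/2⌉;
         +-*-semiring; +-commutativeSemigroup; module ≤-Reasoning)
open import Data.Nat.Tactic.RingSolver using (solve-∀)
open import Data.Bool using (true; false; not; if_then_else_)
open import Data.Fin using (zero; suc; _≟_)
open import Data.Fin.Properties using (any?; suc-injective)
open import Data.Vec using ([]; _∷_; tail; replicate)
open import Data.Product using (∃; _×_; _,_; proj₁; proj₂)
open import Data.Sum using (_⊎_; inj₁; inj₂; map₂)
open import Data.Empty using (⊥; ⊥-elim)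
open import Function using (_∘_)
open import Relation.Nullary using (¬_; Dec; does; yes; no; contradiction)
open import Relation.Nullary.Decidable using (_×-dec_; ¬?)
open import Relation.Unary using (Decidable; _⊆_)
open import Relation.Binary.PropositionalEquality
  using (_≡_; _≢_; refl; sym; trans; cong; cong₂; subst; module ≡-Reasoning)
open import Algebra.Properties.CommutativeSemigroup +-commutativeSemigroup
  using () renaming (interchange to +-interchange)
open import Algebra.Properties.Semiring.Sum +-*-semiring
  using (sum; ∑-distrib-+; sum-cong-≗; sum-replicate-zero)

private
  variable
    A B : Set
    m n : ℕ
    P Q : Fin n → Set

𝟙 : Dec A → ℕ
𝟙 A? = if does A? then 1 else 0

𝟙-yes : (A? : Dec A) → A → 𝟙 A? ≡ 1
𝟙-yes (yes _) _ = refl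
𝟙-yes (no ¬a) a = contradiction a ¬a

𝟙-no : (A? : Dec A) → ¬ A → 𝟙 A? ≡ 0
𝟙-no (yes a) ¬a = contradiction a ¬a
𝟙-no (no _)  _  = refl

𝟙-witness : (A? : Dec A) → 1 ≤ 𝟙 A? → A
𝟙-witness (yes a) _ = a

𝟙-mono : (A → B) → (A? : Dec A) (B? : Dec B) → 𝟙 A? ≤ 𝟙 B?
𝟙-mono A⇒B (yes a) B? = ≤-reflexive (sym (𝟙-yes B? (A⇒B a)))
𝟙-mono A⇒B (no _)  _  = z≤n

+-mono-≤-equal : ∀ {a b c d} → a ≤ c → b ≤ d → c + d ≤ a + b → a ≡ c × b ≡ d
+-mono-≤-equal {a} {b} {c} {d} a≤c b≤d c+d≤a+b =
  ≤-antisym a≤c (+-cancelʳ-≤ d c a (≤-trans c+d≤a+b (+-monoʳ-≤ a b≤d))) ,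
  ≤-antisym b≤d (+-cancelˡ-≤ c d b (≤-trans c+d≤a+b (+-monoˡ-≤ b a≤c)))

half-≤ : ∀ {m n} → m + m ≤ n + n → m ≤ n
half-≤ m+m≤n+n = ≮⇒≥ λ n<m → <⇒≱ (+-mono-< n<m n<m) m+m≤n+n

half-injective : ∀ {m n} → m + m ≡ n + n → m ≡ n
half-injective eq = ≤-antisym (half-≤ (≤-reflexive eq)) (half-≤ (≤-reflexive (sym eq)))

∑-mono-≤ : {f g : Fin n → ℕ} → (∀ i → f i ≤ g i) → sum f ≤ sum g
∑-mono-≤ {zero}  f≤g = z≤n
∑-mono-≤ {suc n} f≤g = +-mono-≤ (f≤g zero) (∑-mono-≤ (f≤g ∘ suc))

∑-mono-≤-equal : {f g : Fin n → ℕ} → (∀ i → f i ≤ g i) → sum g ≤ sum f → ∀ i → f i ≡ g i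
∑-mono-≤-equal {suc n} f≤g ∑g≤∑f i
  with +-mono-≤-equal (f≤g zero) (∑-mono-≤ (f≤g ∘ suc)) ∑g≤∑f
∑-mono-≤-equal {suc n} f≤g ∑g≤∑f zero    | f₀≡g₀ , _   = f₀≡g₀
∑-mono-≤-equal {suc n} f≤g ∑g≤∑f (suc i) | _ , ∑f≡∑g =
  ∑-mono-≤-equal (f≤g ∘ suc) (≤-reflexive (sym ∑f≡∑g)) i

∑-const-1 : ∀ n → sum {n} (λ _ → 1) ≡ n
∑-const-1 zero    = refl
∑-const-1 (suc n) = cong suc (∑-const-1 n)

∑-δ : (x : Fin m) (g : Fin m → ℕ) → sum (λ j → 𝟙 (x ≟ j) * g j) ≡ g x
∑-δ {suc m} zero    g =
  trans (cong₂ _+_ (+-identityʳ (g zero)) (sum-replicate-zero m)) (+-identityʳ (g zero))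
∑-δ {suc m} (suc x) g = ∑-δ x (g ∘ suc)

count : Decidable P → ℕ
count P? = sum (λ i → 𝟙 (P? i))

count-⊆-equal : (P? : Decidable P) (Q? : Decidable Q) → P ⊆ Q → count Q? ≤ count P? → Q ⊆ P
count-⊆-equal P? Q? P⊆Q #Q≤#P {i} q = 𝟙-witness (P? i) (≤-reflexive (begin
  1          ≡⟨ sym (𝟙-yes (Q? i) q) ⟩
  𝟙 (Q? i)   ≡⟨ sym (∑-mono-≤-equal (λ j → 𝟙-mono P⊆Q (P? j) (Q? j)) #Q≤#P i) ⟩
  𝟙 (P? i)   ∎))
  where open ≡-Reasoning

count-cover : ∀ {n} {P Q : Fin n → Set} (P? : Decidable P) (Q? : Decidable Q) →
              (∀ i → P i ⊎ Q i) → n ≤ count P? + count Q?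
count-cover {n} P? Q? P∪Q = begin
  n                                  ≡⟨ sym (∑-const-1 n) ⟩
  sum {n} (λ _ → 1)                  ≤⟨ ∑-mono-≤ covered ⟩
  sum (λ i → 𝟙 (P? i) + 𝟙 (Q? i))    ≡⟨ ∑-distrib-+ {n} _ _ ⟩
  count P? + count Q?                ∎
  where
  open ≤-Reasoning
  covered : ∀ i → 1 ≤ 𝟙 (P? i) + 𝟙 (Q? i)
  covered i with P∪Q i
  ... | inj₁ p = ≤-trans (≤-reflexive (sym (𝟙-yes (P? i) p))) (m≤m+n _ _)
  ... | inj₂ q = ≤-trans (≤-reflexive (sym (𝟙-yes (Q? i) q))) (m≤n+m _ _)

count-all : ∀ {n} {P : Fin n → Set} (P? : Decidable P) → (∀ i → P i) → count P? ≡ n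
count-all {n} P? all = trans (sum-cong-≗ (λ i → 𝟙-yes (P? i) (all i))) (∑-const-1 n)

count-none : ∀ {n} {P : Fin n → Set} (P? : Decidable P) → (∀ i → ¬ P i) → count P? ≡ 0
count-none {n} P? none = trans (sum-cong-≗ (λ i → 𝟙-no (P? i) (none i))) (sum-replicate-zero n)

count-pos : (P? : Decidable P) → ∀ {i} → P i → 1 ≤ count P?
count-pos P? {zero} p rewrite 𝟙-yes (P? zero) p = s≤s z≤n
count-pos P? {suc i} p = ≤-trans (count-pos (P? ∘ suc) p) (m≤n+m _ _)

count-witness : (P? : Decidable P) → 1 ≤ count P? → ∃ P
count-witness {suc n} P? #P≥1 with P? zero
... | yes p = zero , p
... | no _  = let i , p = count-witness (P? ∘ suc) #P≥1 in suc i , p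

unique⇒count-≤1 : (P? : Decidable P) → (∀ {i j} → P i → P j → i ≡ j) → count P? ≤ 1
unique⇒count-≤1 {zero}  P? unique = z≤n
unique⇒count-≤1 {suc n} P? unique with P? zero
... | yes p₀ = s≤s (≤-reflexive (count-none (P? ∘ suc) (λ i pᵢ → contradiction (unique p₀ pᵢ) λ ())))
... | no _   = unique⇒count-≤1 (P? ∘ suc) (λ pᵢ pⱼ → suc-injective (unique pᵢ pⱼ))

count-two : (P? : Decidable P) → ∀ {i j} → i ≢ j → P i → P j → 2 ≤ count P?
count-two P? {zero}  {zero}  0≢0 _  _  = contradiction refl 0≢0
count-two P? {zero}  {suc j} _   p₀ pⱼ rewrite 𝟙-yes (P? zero) p₀ = s≤s (count-pos (P? ∘ suc) pⱼ)
count-two P? {suc i} {zero}  _   pᵢ p₀ rewrite 𝟙-yes (P? zero) p₀ = s≤s (count-pos (P? ∘ suc) pᵢ)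
count-two P? {suc i} {suc j} i≢j pᵢ pⱼ =
  ≤-trans (count-two (P? ∘ suc) (i≢j ∘ cong suc) pᵢ pⱼ) (m≤n+m _ _)

count-≤1⇒unique : (P? : Decidable P) → count P? ≤ 1 → ∀ {i j} → P i → P j → i ≡ j
count-≤1⇒unique P? #P≤1 {i} {j} pᵢ pⱼ with i ≟ j
... | yes i≡j = i≡j
... | no  i≢j = contradiction #P≤1 (<⇒≱ (count-two P? i≢j pᵢ pⱼ))

count-≥2⇒another : (P? : Decidable P) → 2 ≤ count P? → ∀ i → ∃ λ j → j ≢ i × P j
count-≥2⇒another {P = P} P? #P≥2 i with any? (λ j → ¬? (j ≟ i) ×-dec P? j)
... | yes another = another
... | no ¬another =
  contradiction (unique⇒count-≤1 P? λ pⱼ pₗ → trans (only pⱼ) (sym (only pₗ))) (<⇒≱ #P≥2)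
  where
  only : ∀ {j} → P j → j ≡ i
  only {j} pⱼ with j ≟ i
  ... | yes j≡i = j≡i
  ... | no  j≢i = contradiction (j , j≢i , pⱼ) ¬another

∑-fibres : (f : Fin n → Fin m) (g : Fin m → ℕ) →
           sum (g ∘ f) ≡ sum (λ j → count (λ i → f i ≟ j) * g j)
∑-fibres {zero}  {m} f g = sym (sum-replicate-zero m)
∑-fibres {suc n} {m} f g = begin
  g (f zero) + sum (g ∘ f ∘ suc)
    ≡⟨ cong₂ _+_ (sym (∑-δ (f zero) g)) (∑-fibres (f ∘ suc) g) ⟩
  sum (λ j → 𝟙 (f zero ≟ j) * g j) + sum (λ j → tailFibre j * g j)
    ≡⟨ sym (∑-distrib-+ {m} _ _) ⟩
  sum (λ j → 𝟙 (f zero ≟ j) * g j + tailFibre j * g j)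
    ≡⟨ sum-cong-≗ (λ j → sym (*-distribʳ-+ (g j) (𝟙 (f zero ≟ j)) (tailFibre j))) ⟩
  sum (λ j → count (λ i → f i ≟ j) * g j) ∎
  where
  open ≡-Reasoning
  tailFibre : Fin m → ℕ
  tailFibre j = count (λ i → f (suc i) ≟ j)

flip : ∀ {d} → Fin d → Vec Bool d → Vec Bool d
flip zero    (x ∷ v) = not x ∷ v
flip (suc i) (x ∷ v) = x ∷ flip i v

flip-involutive : ∀ {d} (i : Fin d) v → flip i (flip i v) ≡ v
flip-involutive zero    (true  ∷ v) = refl
flip-involutive zero    (false ∷ v) = refl
flip-involutive (suc i) (x ∷ v)     = cong (x ∷_) (flip-involutive i v)

flip-comm : ∀ {d} (i j : Fin d) v → flip i (flip j v) ≡ flip j (flip i v)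
flip-comm zero    zero    v       = refl
flip-comm zero    (suc j) (x ∷ v) = refl
flip-comm (suc i) zero    (x ∷ v) = refl
flip-comm (suc i) (suc j) (x ∷ v) = cong (x ∷_) (flip-comm i j v)

flip-injectiveˡ : ∀ {d} {i j : Fin d} v → flip i v ≡ flip j v → i ≡ j
flip-injectiveˡ {i = zero}  {zero}  v       _ = refl
flip-injectiveˡ {i = zero}  {suc j} (true  ∷ v) ()
flip-injectiveˡ {i = zero}  {suc j} (false ∷ v) ()
flip-injectiveˡ {i = suc i} {zero}  (true  ∷ v) ()
flip-injectiveˡ {i = suc i} {zero}  (false ∷ v) ()
flip-injectiveˡ {i = suc i} {suc j} (x ∷ v) eq = cong suc (flip-injectiveˡ v (cong tail eq))

hamming-refl : ∀ {d} (v : Vec Bool d) → hamming v v ≡ 0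
hamming-refl []          = refl
hamming-refl (true  ∷ v) = hamming-refl v
hamming-refl (false ∷ v) = hamming-refl v

Adj-flip : ∀ {d} (i : Fin d) v → Adj v (flip i v)
Adj-flip zero    (true  ∷ v) = cong suc (hamming-refl v)
Adj-flip zero    (false ∷ v) = cong suc (hamming-refl v)
Adj-flip (suc i) (true  ∷ v) = Adj-flip i v
Adj-flip (suc i) (false ∷ v) = Adj-flip i v

Adj-flip˘ : ∀ {d} (i : Fin d) v → Adj (flip i v) v
Adj-flip˘ i v = subst (Adj (flip i v)) (flip-involutive i v) (Adj-flip i (flip i v))

sumCube : ∀ d → (Vec Bool d → ℕ) → ℕ
sumCube zero    f = f []
sumCube (suc d) f = sumCube d (f ∘ (true ∷_)) + sumCube d (f ∘ (false ∷_))

sumCube-mono-≤ : ∀ d {f g : Vec Bool d → ℕ} → (∀ v → f v ≤ g v) → sumCube d f ≤ sumCube d g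
sumCube-mono-≤ zero    f≤g = f≤g []
sumCube-mono-≤ (suc d) f≤g =
  +-mono-≤ (sumCube-mono-≤ d (f≤g ∘ (true ∷_))) (sumCube-mono-≤ d (f≤g ∘ (false ∷_)))

sumCube-mono-≤-equal : ∀ d {f g : Vec Bool d → ℕ} → (∀ v → f v ≤ g v) →
                       sumCube d g ≤ sumCube d f → ∀ v → f v ≡ g v
sumCube-mono-≤-equal zero    f≤g Σg≤Σf [] = ≤-antisym (f≤g []) Σg≤Σf
sumCube-mono-≤-equal (suc d) f≤g Σg≤Σf (x ∷ v)
  with +-mono-≤-equal (sumCube-mono-≤ d (f≤g ∘ (true ∷_)))
                      (sumCube-mono-≤ d (f≤g ∘ (false ∷_))) Σg≤Σf
... | Σ₁≡ , Σ₀≡ with x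
...   | true  = sumCube-mono-≤-equal d (f≤g ∘ (true ∷_)) (≤-reflexive (sym Σ₁≡)) v
...   | false = sumCube-mono-≤-equal d (f≤g ∘ (false ∷_)) (≤-reflexive (sym Σ₀≡)) v

sumCube-distrib-+ : ∀ d (f g : Vec Bool d → ℕ) →
                    sumCube d (λ v → f v + g v) ≡ sumCube d f + sumCube d g
sumCube-distrib-+ zero    f g = refl
sumCube-distrib-+ (suc d) f g = trans
  (cong₂ _+_ (sumCube-distrib-+ d (f ∘ (true ∷_)) (g ∘ (true ∷_)))
             (sumCube-distrib-+ d (f ∘ (false ∷_)) (g ∘ (false ∷_))))
  (+-interchange (sumCube d (f ∘ (true ∷_))) (sumCube d (g ∘ (true ∷_)))
                 (sumCube d (f ∘ (false ∷_))) (sumCube d (g ∘ (false ∷_))))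

sumCube-∑-comm : ∀ d {n} (f : Vec Bool d → Fin n → ℕ) →
                 sumCube d (λ v → sum (f v)) ≡ sum (λ i → sumCube d (λ v → f v i))
sumCube-∑-comm zero    f = refl
sumCube-∑-comm (suc d) {n} f = trans
  (cong₂ _+_ (sumCube-∑-comm d (f ∘ (true ∷_))) (sumCube-∑-comm d (f ∘ (false ∷_))))
  (sym (∑-distrib-+ {n} _ _))

sumCube-flip : ∀ d (i : Fin d) (f : Vec Bool d → ℕ) → sumCube d (f ∘ flip i) ≡ sumCube d f
sumCube-flip (suc d) zero    f = +-comm (sumCube d (f ∘ (false ∷_))) (sumCube d (f ∘ (true ∷_)))
sumCube-flip (suc d) (suc i) f =
  cong₂ _+_ (sumCube-flip d i (f ∘ (true ∷_))) (sumCube-flip d i (f ∘ (false ∷_)))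

module Neighbourhood {d k} (c : Vec Bool d → Fin k) where

  mult : Vec Bool d → Fin k → ℕ
  mult v j = count (λ i → c (flip i v) ≟ j)

  Unique : Vec Bool d → Fin k → Set
  Unique v j = mult v j ≡ 1

  uniqueNeighbours : Vec Bool d → ℕ
  uniqueNeighbours v = count (λ i → mult v (c (flip i v)) ≟ℕ 1)

  absentColours uniqueColours repeatedColours : Vec Bool d → ℕ
  absentColours   v = count (λ j → mult v j ≟ℕ 0)
  uniqueColours   v = count (λ j → mult v j ≟ℕ 1)
  repeatedColours v = count (λ j → 2 ≤? mult v j)

  mult-flip-pos : ∀ v i → 1 ≤ mult v (c (flip i v))
  mult-flip-pos v i = count-pos (λ l → c (flip l v) ≟ c (flip i v)) refl

  repeated⇒¬Unique : ∀ {v j} → 2 ≤ mult v j → ¬ Unique v j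
  repeated⇒¬Unique ≥2 ≡1 = contradiction (subst (2 ≤_) ≡1 ≥2) λ { (s≤s ()) }

  uniqueNeighbours≡uniqueColours : ∀ v → uniqueNeighbours v ≡ uniqueColours v
  uniqueNeighbours≡uniqueColours v =
    trans (∑-fibres (λ i → c (flip i v)) (λ j → 𝟙 (mult v j ≟ℕ 1)))
          (sum-cong-≗ (λ j → n*𝟙[n≡1]≡𝟙[n≡1] (mult v j)))
    where
    n*𝟙[n≡1]≡𝟙[n≡1] : ∀ n → n * 𝟙 (n ≟ℕ 1) ≡ 𝟙 (n ≟ℕ 1)
    n*𝟙[n≡1]≡𝟙[n≡1] zero          = refl
    n*𝟙[n≡1]≡𝟙[n≡1] (suc zero)    = refl
    n*𝟙[n≡1]≡𝟙[n≡1] (suc (suc n)) = *-zeroʳ (suc (suc n))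

  colours-partition : ∀ v → k ≡ uniqueColours v + (absentColours v + repeatedColours v)
  colours-partition v = begin
    k                    ≡⟨ ∑-const-1 k ⟨
    sum {k} (λ _ → 1)    ≡⟨ sum-cong-≗ (λ j → trichotomy (mult v j)) ⟨
    sum (λ j → 𝟙 (mult v j ≟ℕ 1) + (𝟙 (mult v j ≟ℕ 0) + 𝟙 (2 ≤? mult v j)))
                         ≡⟨ ∑-distrib-+ {k} _ _ ⟩
    uniqueColours v + sum (λ j → 𝟙 (mult v j ≟ℕ 0) + 𝟙 (2 ≤? mult v j))
                         ≡⟨ cong (uniqueColours v +_) (∑-distrib-+ {k} _ _) ⟩
    uniqueColours v + (absentColours v + repeatedColours v) ∎
    where
    open ≡-Reasoning
    trichotomy : ∀ n → 𝟙 (n ≟ℕ 1) + (𝟙 (n ≟ℕ 0) + 𝟙 (2 ≤? n)) ≡ 1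
    trichotomy zero          = refl
    trichotomy (suc zero)    = refl
    trichotomy (suc (suc n)) = refl

  no-repeated⇒uniqueNeighbours≡d : ∀ v → repeatedColours v ≡ 0 → uniqueNeighbours v ≡ d
  no-repeated⇒uniqueNeighbours≡d v none = count-all (λ i → mult v (c (flip i v)) ≟ℕ 1) λ i →
    ≤-antisym (s≤s⁻¹ (≰⇒> (not-repeated (c (flip i v))))) (mult-flip-pos v i)
    where
    not-repeated : ∀ j → ¬ 2 ≤ mult v j
    not-repeated j ≥2 = contradiction (subst (1 ≤_) none (count-pos (λ j → 2 ≤? mult v j) ≥2)) λ ()

m+m≡m⇒m≡0 : ∀ {m} → m + m ≡ m → m ≡ 0
m+m≡m⇒m≡0 {m} m+m≡m = +-cancelˡ-≡ m m 0 (trans m+m≡m (sym (+-identityʳ m)))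

few-colours-bound : ∀ {d k u r} → 3 ≤ d → k + k ≤ d + 4 → u + r < k → (r ≡ 0 → u ≡ d) → u + u ≤ d
few-colours-bound {d} {k} {u} {zero} d≥3 few u<k u≡d =
  contradiction (+-cancelˡ-≤ d 5 4 (begin
    d + 5           ≤⟨ +-monoʳ-≤ d (+-monoˡ-≤ 2 d≥3) ⟩
    d + (d + 2)     ≡⟨ doubling d ⟨
    suc d + suc d   ≤⟨ +-mono-≤ d<k d<k ⟩
    k + k           ≤⟨ few ⟩
    d + 4           ∎))
  (<⇒≱ (n<1+n 4))
  where
  open ≤-Reasoning
  doubling : ∀ d → suc d + suc d ≡ d + (d + 2)
  doubling = solve-∀
  d<k : suc d ≤ k
  d<k = subst (λ x → suc x ≤ k) (trans (+-identityʳ u) (u≡d refl)) u<k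
few-colours-bound {d} {k} {u} {suc r} d≥3 few u+r<k _ = +-cancelʳ-≤ 4 (u + u) d (begin
  u + u + 4           ≡⟨ doubling u ⟩
  (u + 2) + (u + 2)   ≤⟨ +-mono-≤ u+2≤k u+2≤k ⟩
  k + k               ≤⟨ few ⟩
  d + 4               ∎)
  where
  open ≤-Reasoning
  doubling : ∀ u → u + u + 4 ≡ (u + 2) + (u + 2)
  doubling = solve-∀
  u+2≤k : u + 2 ≤ k
  u+2≤k = ≤-trans (≤-reflexive (+-suc u 1)) (≤-trans (s≤s (+-monoʳ-≤ u (s≤s z≤n))) u+r<k)

few-colours-excess : ∀ {k u m} → k ≡ u + m → k + k ≤ (u + u) + 4 → m ≤ 2
few-colours-excess {u = u} {m} refl few =
  half-≤ (+-cancelˡ-≤ (u + u) (m + m) 4 (≤-trans (≤-reflexive (+-interchange u u m m)) few))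

module StarColoured {d k} (c : Vec Bool d → Fin k) (star : StarColouring d k c) where

  open Neighbourhood c

  flip-colour-≢ : ∀ v i → c (flip i v) ≢ c v
  flip-colour-≢ v i eq = proj₁ star v (flip i v) (Adj-flip i v) (sym eq)

  own-colour-absent : ∀ v → mult v (c v) ≡ 0
  own-colour-absent v = count-none (λ i → c (flip i v) ≟ c v) (flip-colour-≢ v)

  absentColours≥1 : ∀ v → 1 ≤ absentColours v
  absentColours≥1 v = count-pos (λ j → mult v j ≟ℕ 0) (own-colour-absent v)

  uniqueNeighbours+repeated<k : ∀ v → uniqueNeighbours v + repeatedColours v < k
  uniqueNeighbours+repeated<k v = begin-strict
    u + r                 <⟨ +-monoʳ-< u (+-monoˡ-≤ r (absentColours≥1 v)) ⟩
    u + a+r               ≡⟨ cong (_+ a+r) (uniqueNeighbours≡uniqueColours v) ⟩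
    uniqueColours v + a+r ≡⟨ colours-partition v ⟨
    k                     ∎
    where
    open ≤-Reasoning
    u = uniqueNeighbours v
    r = repeatedColours v
    a+r = absentColours v + r

  repeated-elsewhere : ∀ v i {j} → c (flip i v) ≡ j → mult v j ≢ 1 → ∃ λ l → l ≢ i × c (flip l v) ≡ j
  repeated-elsewhere v i refl ≢1 =
    count-≥2⇒another (λ l → c (flip l v) ≟ c (flip i v)) (≤∧≢⇒< (mult-flip-pos v i) (≢1 ∘ sym)) i

  no-bicoloured-P₄ : ∀ v i {j l} → j ≢ i → l ≢ i →
                     c (flip j v) ≡ c (flip i v) → c (flip l (flip i v)) ≡ c v → ⊥
  no-bicoloured-P₄ v i {j} {l} j≢i l≢i wu xv =
    proj₂ star w v u x path (c u , c v , inj₁ wu , inj₂ refl , inj₁ refl , inj₂ xv)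
    where
    u = flip i v
    w = flip j v
    x = flip l u
    cu≢cv : c u ≢ c v
    cu≢cv = flip-colour-≢ v i
    path : IsP4 w v u x
    path = Adj-flip˘ j v , Adj-flip i v , Adj-flip l u ,
           (λ w≡v → cu≢cv (trans (sym wu) (cong c w≡v))) ,
           (λ w≡u → j≢i (flip-injectiveˡ v w≡u)) ,
           (λ w≡x → cu≢cv (trans (sym wu) (trans (cong c w≡x) xv))) ,
           (λ v≡u → cu≢cv (sym (cong c v≡u))) ,
           (λ v≡x → l≢i (flip-injectiveˡ u (trans (sym v≡x) (sym (flip-involutive i v))))) ,
           (λ u≡x → cu≢cv (trans (cong c u≡x) xv))

  edge-unique : ∀ v i → Unique v (c (flip i v)) ⊎ Unique (flip i v) (c v)
  edge-unique v i with mult v (c (flip i v)) ≟ℕ 1 | mult (flip i v) (c v) ≟ℕ 1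
  ... | yes unique | _          = inj₁ unique
  ... | no _       | yes unique = inj₂ unique
  ... | no ≢1      | no ≢1′
    with repeated-elsewhere v i refl ≢1
       | repeated-elsewhere (flip i v) i (cong c (flip-involutive i v)) ≢1′
  ...   | j , j≢i , wu | l , l≢i , xv = ⊥-elim (no-bicoloured-P₄ v i j≢i l≢i wu xv)

  uniqueNeighbours-double-counting :
    sumCube d (λ _ → d) ≤ sumCube d (λ v → uniqueNeighbours v + uniqueNeighbours v)
  uniqueNeighbours-double-counting = begin
    sumCube d (λ _ → d)                  ≤⟨ sumCube-mono-≤ d covered ⟩
    sumCube d (λ v → U v + U-across v)   ≡⟨ sumCube-distrib-+ d U U-across ⟩
    sumCube d U + sumCube d U-across     ≡⟨ cong (sumCube d U +_) across≡ ⟩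
    sumCube d U + sumCube d U            ≡⟨ sumCube-distrib-+ d U U ⟨
    sumCube d (λ v → U v + U v)          ∎
    where
    open ≤-Reasoning
    U = uniqueNeighbours
    uniqueAt : Vec Bool d → Fin d → ℕ
    uniqueAt w i = 𝟙 (mult w (c (flip i w)) ≟ℕ 1)
    U-across : Vec Bool d → ℕ
    U-across v = sum (λ i → uniqueAt (flip i v) i)
    covered : ∀ v → d ≤ U v + U-across v
    covered v = count-cover (λ i → mult v (c (flip i v)) ≟ℕ 1)
                            (λ i → mult (flip i v) (c (flip i (flip i v))) ≟ℕ 1) λ i →
      map₂ (subst (Unique (flip i v)) (cong c (sym (flip-involutive i v)))) (edge-unique v i)
    across≡ : sumCube d U-across ≡ sumCube d U
    across≡ = begin-equality
      sumCube d U-across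
        ≡⟨ sumCube-∑-comm d (λ v i → uniqueAt (flip i v) i) ⟩
      sum (λ i → sumCube d (λ v → uniqueAt (flip i v) i))
        ≡⟨ sum-cong-≗ (λ i → sumCube-flip d i (λ w → uniqueAt w i)) ⟩
      sum (λ i → sumCube d (λ v → uniqueAt v i))
        ≡⟨ sumCube-∑-comm d uniqueAt ⟨
      sumCube d U ∎

  own-colour-unique : ∀ v i → 2 ≤ mult v (c (flip i v)) → Unique (flip i v) (c v)
  own-colour-unique v i ≥2 with edge-unique v i
  ... | inj₁ ≡1     = contradiction ≡1 (repeated⇒¬Unique ≥2)
  ... | inj₂ unique = unique

  repeated-class-unique : ∀ v i l → 2 ≤ mult v (c (flip i v)) → c (flip l v) ≡ c (flip i v) →
                          Unique (flip i v) (c (flip l (flip i v)))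
  repeated-class-unique v i l ≥2 same with l ≟ i
  ... | yes refl = subst (Unique (flip i v)) (cong c (sym (flip-involutive i v))) (own-colour-unique v i ≥2)
  ... | no l≢i with edge-unique (flip i v) l
  ...   | inj₁ unique = unique
  ...   | inj₂ ≡1     = contradiction ≡1 (repeated⇒¬Unique two-neighbours)
    where
    u = flip i v
    two-neighbours : 2 ≤ mult (flip l u) (c u)
    two-neighbours = count-two (λ m → c (flip m (flip l u)) ≟ c u) l≢i (cong c (flip-involutive l u))
      (trans (cong c (trans (flip-comm i l u) (cong (flip l) (flip-involutive i v)))) same)

  module FewColours (d≥3 : 3 ≤ d) (few : k + k ≤ d + 4) where

    uniqueNeighbours-half : ∀ v → uniqueNeighbours v + uniqueNeighbours v ≡ d
    uniqueNeighbours-half = sumCube-mono-≤-equal d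
      (λ v → few-colours-bound d≥3 few (uniqueNeighbours+repeated<k v) (no-repeated⇒uniqueNeighbours≡d v))
      uniqueNeighbours-double-counting

    absent+repeated≤2 : ∀ v → absentColours v + repeatedColours v ≤ 2
    absent+repeated≤2 v = few-colours-excess {u = u} partition
                            (subst (λ n → k + k ≤ n + 4) (sym (uniqueNeighbours-half v)) few)
      where
      u = uniqueNeighbours v
      partition : k ≡ u + (absentColours v + repeatedColours v)
      partition = subst (λ n → k ≡ n + (absentColours v + repeatedColours v))
                        (sym (uniqueNeighbours≡uniqueColours v)) (colours-partition v)

    repeatedColours≥1 : ∀ v → 1 ≤ repeatedColours v
    repeatedColours≥1 v = n≢0⇒n>0 λ none →
      let d+d≡d = subst (λ n → n + n ≡ d) (no-repeated⇒uniqueNeighbours≡d v none) (uniqueNeighbours-half v)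
      in contradiction (subst (3 ≤_) (m+m≡m⇒m≡0 d+d≡d) d≥3) λ ()

    absentColours≤1 : ∀ v → absentColours v ≤ 1
    absentColours≤1 v = +-cancelʳ-≤ 1 (absentColours v) 1
      (≤-trans (+-monoʳ-≤ (absentColours v) (repeatedColours≥1 v)) (absent+repeated≤2 v))

    repeatedColours≤1 : ∀ v → repeatedColours v ≤ 1
    repeatedColours≤1 v = +-cancelˡ-≤ 1 (repeatedColours v) 1
      (≤-trans (+-monoˡ-≤ (repeatedColours v) (absentColours≥1 v)) (absent+repeated≤2 v))

    repeated-unique : ∀ v {e b} → 2 ≤ mult v e → 2 ≤ mult v b → e ≡ b
    repeated-unique v = count-≤1⇒unique (λ j → 2 ≤? mult v j) (repeatedColours≤1 v)

    repeated-exists : ∀ v → ∃ λ b → 2 ≤ mult v b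
    repeated-exists v = count-witness (λ j → 2 ≤? mult v j) (repeatedColours≥1 v)

    present : ∀ v {e} → e ≢ c v → 1 ≤ mult v e
    present v e≢cv = n≢0⇒n>0 λ absent →
      e≢cv (count-≤1⇒unique (λ j → mult v j ≟ℕ 0) (absentColours≤1 v) absent (own-colour-absent v))

    unique-or-repeated : ∀ v {b} → 2 ≤ mult v b → ∀ i → Unique v (c (flip i v)) ⊎ c (flip i v) ≡ b
    unique-or-repeated v ≥2 i with mult v (c (flip i v)) ≟ℕ 1
    ... | yes unique = inj₁ unique
    ... | no ≢1      = inj₂ (repeated-unique v (≤∧≢⇒< (mult-flip-pos v i) (≢1 ∘ sym)) ≥2)

    uniqueNeighbours≤repeated : ∀ v {b} → 2 ≤ mult v b → uniqueNeighbours v ≤ mult v b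
    uniqueNeighbours≤repeated v {b} ≥2 = +-cancelˡ-≤ u u (mult v b)
      (subst (_≤ u + mult v b) (sym (uniqueNeighbours-half v))
        (count-cover (λ i → mult v (c (flip i v)) ≟ℕ 1) (λ i → c (flip i v) ≟ b) (unique-or-repeated v ≥2)))
      where
      u = uniqueNeighbours v

    unique-at-repeated-neighbour : ∀ v i → 2 ≤ mult v (c (flip i v)) → ∀ {l} →
                                   Unique (flip i v) (c (flip l (flip i v))) → c (flip l v) ≡ c (flip i v)
    unique-at-repeated-neighbour v i ≥2 = count-⊆-equal
      (λ l → c (flip l v) ≟ c u) (λ l → mult u (c (flip l u)) ≟ℕ 1)
      (λ {l} → repeated-class-unique v i l ≥2)
      (subst (_≤ mult v (c u)) same-uniqueNeighbours (uniqueNeighbours≤repeated v ≥2))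
      where
      u = flip i v
      same-uniqueNeighbours : uniqueNeighbours v ≡ uniqueNeighbours u
      same-uniqueNeighbours = half-injective (trans (uniqueNeighbours-half v) (sym (uniqueNeighbours-half u)))

    colour-clash : ∀ v i {e} → 2 ≤ mult v (c (flip i v)) → 2 ≤ mult (flip i v) e → ⊥
    colour-clash v i {e} v-≥2 u-e≥2 =
      let l , cl≡e = count-witness (λ l → c (flip l v) ≟ e) (present v e≢cv)
      in flip-colour-≢ (flip l v) i (begin
           c (flip i (flip l v))   ≡⟨ cong c (flip-comm i l v) ⟩
           c (flip l u)            ≡⟨ colour-at-u cl≡e ⟩
           e                       ≡⟨ cl≡e ⟨
           c (flip l v)            ∎)
      where
      open ≡-Reasoning
      u = flip i v
      e≢cv : e ≢ c v
      e≢cv refl = repeated⇒¬Unique u-e≥2 (own-colour-unique v i v-≥2)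
      e≢cu : e ≢ c u
      e≢cu refl = contradiction (subst (2 ≤_) (own-colour-absent u) u-e≥2) λ ()
      colour-at-u : ∀ {l} → c (flip l v) ≡ e → c (flip l u) ≡ e
      colour-at-u {l} cl≡e with unique-or-repeated u u-e≥2 l
      ... | inj₁ unique = contradiction (trans (sym cl≡e) (unique-at-repeated-neighbour v i v-≥2 unique)) e≢cu
      ... | inj₂ clu≡e  = clu≡e

    no-vertex : Vec Bool d → ⊥
    no-vertex v =
      let b , v-b≥2 = repeated-exists v
          i , ci≡b  = count-witness (λ i → c (flip i v) ≟ b) (≤-trans (s≤s z≤n) v-b≥2)
          e , u-e≥2 = repeated-exists (flip i v)
      in colour-clash v i (subst (λ j → 2 ≤ mult v j) (sym ci≡b) v-b≥2) u-e≥2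

  star-colours-bound : 3 ≤ d → d + 5 ≤ k + k
  star-colours-bound d≥3 with d + 5 ≤? k + k
  ... | yes bound = bound
  ... | no ¬bound = ⊥-elim (FewColours.no-vertex d≥3 few (replicate d false))
    where
    few : k + k ≤ d + 4
    few = s≤s⁻¹ (subst (suc (k + k) ≤_) (+-suc d 4) (≰⇒> ¬bound))

corollary1 : (d : ℕ) → 3 ≤ d → (k : ℕ) → (c : Vec Bool d → Fin k) →
             StarColouring d k c → ⌈ d + 5 /2⌉ ≤ k
corollary1 d d≥3 k c star = begin
  ⌈ d + 5 /2⌉   ≤⟨ ⌈n/2⌉-mono (StarColoured.star-colours-bound c star d≥3) ⟩
  ⌈ k + k /2⌉   ≡⟨ n≡⌈n+n/2⌉ k ⟨
  k             ∎
  where open ≤-Reasoning
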